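{- Let $k,m,n\geqslant 0$. The set of elements $(x_1,\dots,x_n)\in C^n_{k+m}$ satisfying the condition "for each $i\in\{1,\dots,n-1\}$, if $x_{i+1}\in\{0,\dots,k-1\}$ then $x_i\leqslant x_{i+1}$" is closed under binary meets and binary joins of $C^n_{k+m}$.
   Context: $C_r$ is the chain $\{0<1<\dots<r\}$ and $C^n_r$ its $n$-th cartesian power with componentwise order; meets and joins are componentwise minimum and maximum. -}

module Defs where

open import Data.Nat using (ℕ; suc; _+_; _≤_; _<_; _⊓_; _⊔_)
open import Data.Fin using (Fin; toℕ)
open import Data.Product using (_×_)
open import Relation.Binary.PropositionalEquality using (_≡_)

-- An element of C^n_r : a function Fin n → ℕ with all values ≤ r
-- (coordinates indexed 0..n-1 instead of 1..n).
InChainPower : (n r : ℕ) → (Fin n → ℕ) → Set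
InChainPower n r x = ∀ (i : Fin n) → x i ≤ r

meet : {n : ℕ} → (Fin n → ℕ) → (Fin n → ℕ) → (Fin n → ℕ)
meet x y i = x i ⊓ y i

join : {n : ℕ} → (Fin n → ℕ) → (Fin n → ℕ) → (Fin n → ℕ)
join x y i = x i ⊔ y i

Cond : (n k : ℕ) → (Fin n → ℕ) → Set
Cond n k x = ∀ (i j : Fin n) → toℕ j ≡ suc (toℕ i) → x j < k → x i ≤ x j

S : (k m n : ℕ) → (Fin n → ℕ) → Set
S k m n x = InChainPower n (k + m) x × Cond n k x

-- Both bounds x ≤ k + m and the implication "x_{i+1} < k ⇒ x_i ≤ x_{i+1}" are
-- conditions on one or two coordinates at a time, so it suffices to check that
-- they survive ⊓ and ⊔ of natural numbers. For ⊔, if c ⊔ d < k then both c and d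
-- are below k and both implications fire; for ⊓, c ⊓ d is one of c, d, and the
-- implication for that one already suffices.
module Submission where

open import Defs
open import Data.Nat using (ℕ; _≤_; _<_; _⊓_; _⊔_)
open import Data.Nat.Properties
open import Data.Fin using (Fin)
open import Data.Product using (_×_; _,_)
open import Data.Sum using (inj₁; inj₂)

⊓-pres-guarded-≤ : ∀ {k a b c d} → (c < k → a ≤ c) → (d < k → b ≤ d) →
                   c ⊓ d < k → a ⊓ b ≤ c ⊓ d
⊓-pres-guarded-≤ {a = a} {b} {c} {d} a≤c b≤d c⊓d<k with ≤-total c d
... | inj₁ c≤d rewrite m≤n⇒m⊓n≡m c≤d = ≤-trans (m⊓n≤m a b) (a≤c c⊓d<k)
... | inj₂ d≤c rewrite m≥n⇒m⊓n≡n d≤c = ≤-trans (m⊓n≤n a b) (b≤d c⊓d<k)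

⊔-pres-guarded-≤ : ∀ {k a b c d} → (c < k → a ≤ c) → (d < k → b ≤ d) →
                   c ⊔ d < k → a ⊔ b ≤ c ⊔ d
⊔-pres-guarded-≤ {c = c} {d} a≤c b≤d c⊔d<k =
  ⊔-mono-≤ (a≤c (≤-<-trans (m≤m⊔n c d) c⊔d<k)) (b≤d (≤-<-trans (m≤n⊔m c d) c⊔d<k))

meet-InChainPower : ∀ {n r} {x y : Fin n → ℕ} →
                    InChainPower n r x → InChainPower n r y → InChainPower n r (meet x y)
meet-InChainPower {x = x} {y} x≤r _ i = m≤n⇒m⊓o≤n (y i) (x≤r i)

join-InChainPower : ∀ {n r} {x y : Fin n → ℕ} →
                    InChainPower n r x → InChainPower n r y → InChainPower n r (join x y)
join-InChainPower x≤r y≤r i = ⊔-lub (x≤r i) (y≤r i)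

meet-Cond : ∀ {n k} {x y : Fin n → ℕ} → Cond n k x → Cond n k y → Cond n k (meet x y)
meet-Cond condx condy i j j≡1+i = ⊓-pres-guarded-≤ (condx i j j≡1+i) (condy i j j≡1+i)

join-Cond : ∀ {n k} {x y : Fin n → ℕ} → Cond n k x → Cond n k y → Cond n k (join x y)
join-Cond condx condy i j j≡1+i = ⊔-pres-guarded-≤ (condx i j j≡1+i) (condy i j j≡1+i)

lemma4p2 : (k m n : ℕ) → (x y : Fin n → ℕ) → S k m n x → S k m n y →
    S k m n (meet x y) × S k m n (join x y)
lemma4p2 k m n x y (x≤k+m , condx) (y≤k+m , condy) =
  (meet-InChainPower x≤k+m y≤k+m , meet-Cond condx condy) ,
  (join-InChainPower x≤k+m y≤k+m , join-Cond condx condy)
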